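{- Let $n\in\mathbb{Z}^+$. (i) Let $C,D\in\mathbb{N}_m$ with $|C|,|D|\ge2$, where $C=\{0,c_2,c_3,\dots\}$ with $0<c_2\le c_3\le\cdots$. If $\underline{\alpha},\underline{\beta}\in\mathbb{Z}^+_m$ satisfy $(\underline{\alpha}C)\cap[c_2n]_m=(\underline{\beta}D)\cap[c_2n]_m$ and $C\cap[c_2n]_m=D\cap[c_2n]_m$, then $\underline{\alpha}\cap[n]_m=\underline{\beta}\cap[n]_m$. (ii) Let $\underline{\alpha}=(\alpha_1,\dots,\alpha_s),\underline{\beta}\in\mathbb{Z}^+_m$ and $C,D\in\mathbb{N}_m$ with $\underline{\alpha}\cap[\alpha_1n]_m=\underline{\beta}\cap[\alpha_1n]_m$ and $(\underline{\alpha}C)\cap[\alpha_1n]_m=(\underline{\beta}D)\cap[\alpha_1n]_m$. Then $C\cap[n]_m=D\cap[n]_m$. (iii) Let $\underline{\alpha}=(\alpha_1,\dots,\alpha_s),\underline{\alpha}',\underline{\beta},\underline{\beta}'\in\mathbb{Z}^+_m$ with $\underline{\alpha}\cap[\alpha_1n]_m=\underline{\beta}\cap[\alpha_1n]_m$ and $(\underline{\alpha}\,\underline{\alpha}')\cap[\alpha_1n]_m=(\underline{\beta}\,\underline{\beta}')\cap[\alpha_1n]_m$. Then $\underline{\alpha}'\cap[n]_m=\underline{\beta}'\cap[n]_m$.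
   Context: A multiset $M$ of nonnegative integers is described by its multiplicity function $\chi_M$; $|M|=\sum_n\chi_M(n)$. $\mathbb{N}_m$ is the family of multisets $M$ with $\chi_M(0)=1$, $\chi_M(n)<\infty$ for $n\ge1$. $\mathbb{Z}^+_m$ is the set of finite vectors $(\alpha_1,\dots,\alpha_s)$ ($s\ge1$ arbitrary) of positive integers with $\alpha_1\le\cdots\le\alpha_s$. $kA=\{ka\}$ with multiplicities, sums of multisets count all pairs with multiplicity, and $\underline{\alpha}A=\alpha_1A+\cdots+\alpha_sA$. For vectors $\underline{\alpha}=(\alpha_1,\dots,\alpha_s)$, $\underline{\beta}=(\beta_1,\dots,\beta_t)$, $\underline{\alpha}\,\underline{\beta}$ is the vector of all $st$ products $\alpha_i\beta_j$ in nondecreasing order. For a multiset $A$ and positive integer $x$, $A\cap[x]_m$ is the multiset of elements $a\in A$ with $a\le x$ (with their multiplicities); for a vector $\underline{\alpha}$, $\underline{\alpha}\cap[x]_m=(\alpha_1,\dots,\alpha_k)$ where $\alpha_k\le x$ and $\alpha_{k+1}>x$ or does not exist. -}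

module Defs where

open import Data.Nat using (ℕ; zero; suc; _+_; _*_; _∸_; _≤_; _<_)
open import Data.Nat.Properties using (_≤?_; ≤-totalOrder; ≤-decTotalOrder)
open import Data.Nat.Divisibility using (_∣?_)
open import Data.Nat.DivMod using (_/_)
open import Data.List using (List; []; _∷_; foldr; map; concatMap; takeWhile)
open import Data.List.Relation.Unary.All using (All)
open import Data.List.Relation.Unary.Sorted.TotalOrder ≤-totalOrder using (Sorted)
open import Data.List.Sort ≤-decTotalOrder using (sort)
open import Data.Product using (_×_; ∃-syntax)
open import Relation.Binary.PropositionalEquality using (_≡_)
open import Relation.Nullary.Decidable using (Dec; yes; no)

-- A multiset of nonnegative integers, given by its multiplicity function χ.
-- (Each multiplicity is a natural number, hence finite.)
Multiset : Set
Multiset = ℕ → ℕ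

InNm : Multiset → Set
InNm χ = χ 0 ≡ 1

-- |M| ≥ 2 for M ∈ ℕ_m : some positive element is present.
CardGe2 : Multiset → Set
CardGe2 χ = ∃[ m ] (0 < m × 1 ≤ χ m)

sumUpTo : ℕ → (ℕ → ℕ) → ℕ
sumUpTo zero    f = f 0
sumUpTo (suc n) f = sumUpTo n f + f (suc n)

-- Multiset sum A + B: all pairs counted with multiplicity.
_⊕_ : Multiset → Multiset → Multiset
(A ⊕ B) n = sumUpTo n (λ i → A i * B (n ∸ i))

zeroMS : Multiset
zeroMS zero    = 1
zeroMS (suc _) = 0

-- kA = {ka : a ∈ A} with multiplicities (k positive; k = 0 never used).
scale : ℕ → Multiset → Multiset
scale zero    A n = 0
scale (suc k) A n with suc k ∣? n
... | yes _ = A (n / suc k)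
... | no  _ = 0

-- α A = α₁A + ⋯ + α_sA  (folded with the neutral element {0}).
vecMul : List ℕ → Multiset → Multiset
vecMul α A = foldr (λ a M → scale a A ⊕ M) zeroMS α

-- ℤ⁺_m : nonempty nondecreasing vectors of positive integers,
-- written α₁ ∷ rest.
InZm : List ℕ → Set
InZm α = All (0 <_) α × Sorted α

vecProd : List ℕ → List ℕ → List ℕ
vecProd α β = sort (concatMap (λ a → map (a *_) β) α)

-- α ∩ [x]_m : the longest prefix with entries ≤ x.
truncV : ℕ → List ℕ → List ℕ
truncV x α = takeWhile (_≤? x) α

TruncEqM : ℕ → Multiset → Multiset → Set
TruncEqM x A B = ∀ m → m ≤ x → A m ≡ B m

-- Everything is read off at the smallest element that can tell the two sides apart.
-- (i) If the least entries a < b of α and β differ (a ≤ n), then αC contains c₂a, coming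
-- from a·c₂, whereas βD does not: D has no element in (0, c₂), so each summand b·d with
-- d ≠ 0 is at least c₂b > c₂a.  Hence a = b, and the common summand aC = aD is cancelled,
-- which is possible since it contains 0 exactly once.
-- (ii) Strong induction on m ≤ n.  If C and D agree below m, the multiplicities of a₁m in
-- αC and in αD are R + k·C(m) and R + k·D(m) with the same R, where k ≥ 1 is the number of
-- entries a₁ in α (larger entries only see C below m).  Up to a₁n, αD = βD since α and β
-- agree there, so C(m) = D(m).
-- (iii) The same argument for the multiplicity function of αα', which is Σ_{a ∈ α} aA' with
-- A' the multiplicity function of α'.
module Submission where

open import Defs
open import Data.Nat
open import Data.Nat.Properties
open import Data.Nat.Divisibility using (_∣?_; divides)
open import Data.Nat.DivMod using (m*n/n≡m)
open import Data.Nat.Induction using (<-rec)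
open import Data.Nat.Solver using (module +-*-Solver)
open import Data.List using (List; []; _∷_; [_]; _++_; map; concatMap; filter; length)
open import Data.List.Properties using (length-++; filter-++; filter-accept; filter-reject; filter-none; filter-some)
open import Data.List.Relation.Unary.All as All using (All; []; _∷_)
open import Data.List.Relation.Unary.All.Properties using (takeWhile⁺; map⁺)
open import Data.List.Relation.Unary.Any using (here)
open import Data.List.Relation.Unary.Linked.Properties using (Linked⇒All)
open import Data.List.Relation.Unary.Sorted.TotalOrder ≤-totalOrder using (Sorted)
open import Data.List.Relation.Unary.Linked as Linked using ()
open import Data.List.Relation.Binary.Permutation.Propositional using (_↭_)
open import Data.List.Relation.Binary.Permutation.Propositional.Properties using (↭-length; filter-↭)
open import Data.List.Sort ≤-decTotalOrder using (sort-↭; sort-↗)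
open import Data.Empty using (⊥; ⊥-elim)
open import Data.Product using (_×_; _,_; ∃-syntax)
open import Function using (_∘_; _∘₂_)
open import Function.Definitions using (Injective)
open import Relation.Binary.Definitions using (tri<; tri≈; tri>)
open import Relation.Binary.PropositionalEquality hiding ([_])
open import Relation.Nullary using (yes; no)
open import Relation.Nullary.Decidable using (dec-true; dec-false)
open +-*-Solver

truncV-≤ : ∀ {x a} as → a ≤ x → truncV x (a ∷ as) ≡ a ∷ truncV x as
truncV-≤ {x} {a} as a≤x rewrite dec-true (a ≤? x) a≤x = refl

truncV-> : ∀ {x a} as → x < a → truncV x (a ∷ as) ≡ []
truncV-> {x} {a} as x<a rewrite dec-false (a ≤? x) (<⇒≱ x<a) = refl

Sorted⇒All-≥ : ∀ {a as} → Sorted (a ∷ as) → All (a ≤_) (a ∷ as)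
Sorted⇒All-≥ = Linked⇒All ≤-trans ≤-refl

Sorted⇒All-> : ∀ {x a as} → x < a → Sorted (a ∷ as) → All (x <_) (a ∷ as)
Sorted⇒All-> x<a as↗ = All.map (<-≤-trans x<a) (Sorted⇒All-≥ as↗)

module _ (x : ℕ) (R : List ℕ → List ℕ → Set)
  (unmatchedˡ : ∀ {a as L} → a ≤ x → All (a <_) L → R (a ∷ as) L → ⊥)
  (unmatchedʳ : ∀ {a as L} → a ≤ x → All (a <_) L → R L (a ∷ as) → ⊥)
  (R-tail : ∀ {a as bs} → a ≤ x → R (a ∷ as) (a ∷ bs) → R as bs)
  where

  private
    both-above : ∀ {a b} as bs → x < a → x < b → truncV x (a ∷ as) ≡ truncV x (b ∷ bs)
    both-above as bs x<a x<b = trans (truncV-> as x<a) (sym (truncV-> bs x<b))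

  truncV-≡-byLeast : ∀ {α β} → Sorted α → Sorted β → R α β → truncV x α ≡ truncV x β
  truncV-≡-byLeast {[]} {[]} _ _ _ = refl
  truncV-≡-byLeast {[]} {b ∷ bs} _ _ r with b ≤? x
  ... | yes b≤x = ⊥-elim (unmatchedʳ b≤x [] r)
  ... | no  b≰x = sym (truncV-> bs (≰⇒> b≰x))
  truncV-≡-byLeast {a ∷ as} {[]} _ _ r with a ≤? x
  ... | yes a≤x = ⊥-elim (unmatchedˡ a≤x [] r)
  ... | no  a≰x = truncV-> as (≰⇒> a≰x)
  truncV-≡-byLeast {a ∷ as} {b ∷ bs} α↗ β↗ r with <-cmp a b | a ≤? x | b ≤? x
  ... | tri< a<b _ _ | yes a≤x | _       = ⊥-elim (unmatchedˡ a≤x (Sorted⇒All-> a<b β↗) r)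
  ... | tri< a<b _ _ | no  a≰x | _       = both-above as bs (≰⇒> a≰x) (<-trans (≰⇒> a≰x) a<b)
  ... | tri> _ _ b<a | _       | yes b≤x = ⊥-elim (unmatchedʳ b≤x (Sorted⇒All-> b<a α↗) r)
  ... | tri> _ _ b<a | _       | no  b≰x = both-above as bs (<-trans (≰⇒> b≰x) b<a) (≰⇒> b≰x)
  ... | tri≈ _ refl _ | no a≰x | _       = both-above as bs (≰⇒> a≰x) (≰⇒> a≰x)
  ... | tri≈ _ refl _ | yes a≤x | _      =
    trans (truncV-≤ as a≤x)
      (trans (cong (a ∷_) (truncV-≡-byLeast (Linked.tail α↗) (Linked.tail β↗) (R-tail a≤x r)))
        (sym (truncV-≤ bs a≤x)))

multiplicity : List ℕ → Multiset
multiplicity L x = length (filter (_≟ x) L)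

multiplicity-++ : ∀ L L' x → multiplicity (L ++ L') x ≡ multiplicity L x + multiplicity L' x
multiplicity-++ L L' x = trans (cong length (filter-++ (_≟ x) L L')) (length-++ (filter (_≟ x) L))

multiplicity-↭ : ∀ {L L'} x → L ↭ L' → multiplicity L x ≡ multiplicity L' x
multiplicity-↭ x L↭L' = ↭-length (filter-↭ (_≟ x) L↭L')

multiplicity-here : ∀ x L → multiplicity (x ∷ L) x ≡ suc (multiplicity L x)
multiplicity-here x L = cong length (filter-accept (_≟ x) refl)

multiplicity-there : ∀ {x y} L → y ≢ x → multiplicity (y ∷ L) x ≡ multiplicity L x
multiplicity-there {x} L y≢x = cong length (filter-reject (_≟ x) y≢x)

multiplicity-∉ : ∀ {x L} → All (_≢ x) L → multiplicity L x ≡ 0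
multiplicity-∉ {x} L∌x = cong length (filter-none (_≟ x) L∌x)

multiplicity-absent : ∀ {x L} → All (x <_) L → multiplicity L x ≡ 0
multiplicity-absent x<L = multiplicity-∉ (All.map >⇒≢ x<L)

multiplicity-∷-cong : ∀ a {L L' x} → multiplicity L x ≡ multiplicity L' x →
  multiplicity (a ∷ L) x ≡ multiplicity (a ∷ L') x
multiplicity-∷-cong a {L} {L'} {x} eq =
  trans (multiplicity-++ [ a ] L x) (trans (cong (multiplicity [ a ] x +_) eq) (sym (multiplicity-++ [ a ] L' x)))

multiplicity-map : ∀ {f} → Injective _≡_ _≡_ f → ∀ L y → multiplicity (map f L) (f y) ≡ multiplicity L y
multiplicity-map f-inj [] y = refl
multiplicity-map {f} f-inj (z ∷ L) y with z ≟ y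
... | yes refl = trans (multiplicity-here (f z) (map f L))
                   (trans (cong suc (multiplicity-map f-inj L z)) (sym (multiplicity-here z L)))
... | no z≢y   = trans (multiplicity-there (map f L) (z≢y ∘ f-inj))
                   (trans (multiplicity-map f-inj L y) (sym (multiplicity-there L z≢y)))

multiplicity-truncV : ∀ {x y} L → Sorted L → y ≤ x → multiplicity (truncV x L) y ≡ multiplicity L y
multiplicity-truncV [] _ _ = refl
multiplicity-truncV {x} {y} (a ∷ as) L↗ y≤x with a ≤? x
... | yes a≤x = trans (cong (λ l → multiplicity l y) (truncV-≤ as a≤x))
                  (multiplicity-∷-cong a (multiplicity-truncV as (Linked.tail L↗) y≤x))
... | no  a≰x = trans (cong (λ l → multiplicity l y) (truncV-> as (≰⇒> a≰x)))
                  (sym (multiplicity-absent (Sorted⇒All-> (≤-<-trans y≤x (≰⇒> a≰x)) L↗)))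

multiplicity-truncV-head : ∀ {x a} as → a ≤ x → 0 < multiplicity (truncV x (a ∷ as)) a
multiplicity-truncV-head {x} {a} as a≤x =
  subst (λ l → 0 < multiplicity l a) (sym (truncV-≤ as a≤x)) (filter-some (_≟ a) (here refl))

truncV-≡-byMultiplicity : ∀ {x L L'} → Sorted L → Sorted L' →
  TruncEqM x (multiplicity L) (multiplicity L') → truncV x L ≡ truncV x L'
truncV-≡-byMultiplicity {x} =
  truncV-≡-byLeast x SameUpTo unmatched (λ a≤x a<L eq → unmatched a≤x a<L (sym ∘₂ eq)) tail
  where
  SameUpTo : List ℕ → List ℕ → Set
  SameUpTo L L' = TruncEqM x (multiplicity L) (multiplicity L')
  unmatched : ∀ {a as L} → a ≤ x → All (a <_) L → SameUpTo (a ∷ as) L → ⊥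
  unmatched {a} {as} a≤x a<L eq =
    <⇒≢ (filter-some (_≟ a) (here refl)) (sym (trans (eq a a≤x) (multiplicity-absent a<L)))
  tail : ∀ {a as bs} → a ≤ x → SameUpTo (a ∷ as) (a ∷ bs) → SameUpTo as bs
  tail {a} {as} {bs} _ eq y y≤x = +-cancelˡ-≡ (multiplicity [ a ] y) _ _
    (trans (sym (multiplicity-++ [ a ] as y)) (trans (eq y y≤x) (multiplicity-++ [ a ] bs y)))

*-positive : ∀ {m n} → 0 < m → 0 < n → 0 < m * n
*-positive {suc _} {suc _} _ _ = z<s

multiple-≥ : ∀ {q a i} → q * a ≡ i → 0 < i → a ≤ i
multiple-≥ {suc q} {a} refl _ = m≤m+n a (q * a)

quotient-≤ : ∀ {q a i} → 0 < a → q * a ≡ i → q ≤ i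
quotient-≤ {q} {suc k} _ refl = m≤m*n q (suc k)

scale-multiple : ∀ {a} → 0 < a → ∀ C q → scale a C (q * a) ≡ C q
scale-multiple {suc k} _ C q with suc k ∣? q * suc k
... | yes _  = cong C (m*n/n≡m q (suc k))
... | no  ∤ = ⊥-elim (∤ (divides q refl))

scale-0 : ∀ {a} → 0 < a → ∀ C → scale a C 0 ≡ C 0
scale-0 0<a C = scale-multiple 0<a C 0

scale-elim : ∀ a {C D i} (P : ℕ → ℕ → Set) → P 0 0 → (∀ q → q * a ≡ i → P (C q) (D q)) →
  P (scale a C i) (scale a D i)
scale-elim zero    P P00 _ = P00
scale-elim (suc k) {C} {D} {i} P P00 P-at with suc k ∣? i
... | yes (divides q i≡qa) =
  subst (λ j → P (C j) (D j)) (sym (trans (cong (_/ suc k) i≡qa) (m*n/n≡m q (suc k)))) (P-at q (sym i≡qa))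
... | no _ = P00

scale-cong : ∀ a {C D i} → (∀ q → q * a ≡ i → C q ≡ D q) → scale a C i ≡ scale a D i
scale-cong a = scale-elim a _≡_ refl

scale-vanish : ∀ a {C i} → (∀ q → q * a ≡ i → C q ≡ 0) → scale a C i ≡ 0
scale-vanish a {C} = scale-elim a {C} {C} (λ x _ → x ≡ 0) refl

multiplicity-scale : ∀ {a} → 0 < a → ∀ L x → multiplicity (map (a *_) L) x ≡ scale a (multiplicity L) x
multiplicity-scale {a@(suc k)} _ L x with a ∣? x
... | yes (divides q refl) = begin
  multiplicity (map (a *_) L) (q * a) ≡⟨ cong (multiplicity (map (a *_) L)) (*-comm q a) ⟩
  multiplicity (map (a *_) L) (a * q) ≡⟨ multiplicity-map (*-cancelˡ-≡ _ _ a) L q ⟩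
  multiplicity L q                    ≡⟨ cong (multiplicity L) (sym (m*n/n≡m q a)) ⟩
  multiplicity L (q * a / a)          ∎
  where open ≡-Reasoning
... | no ∤ =
  multiplicity-∉ (map⁺ (All.universal (λ y ay≡x → ∤ (divides y (trans (sym ay≡x) (*-comm a y)))) L))

AgreeBelow : ℕ → Multiset → Multiset → Set
AgreeBelow m A B = ∀ i → i < m → A i ≡ B i

agree-upTo : ∀ n {A B : Multiset} → (∀ m → m ≤ n → AgreeBelow m A B → A m ≡ B m) → TruncEqM n A B
agree-upTo n {A} {B} step = <-rec (λ i → i ≤ n → A i ≡ B i)
  (λ i rec i≤n → step i i≤n (λ j j<i → rec j<i (≤-trans (<⇒≤ j<i) i≤n)))

scale-agree : ∀ a {m C D} → AgreeBelow m C D → AgreeBelow (m * a) (scale a C) (scale a D)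
scale-agree a {m} C≈D i i<ma =
  scale-cong a (λ q qa≡i → C≈D q (*-cancelʳ-< a q m (subst (_< m * a) (sym qa≡i) i<ma)))

scale-agree-≥ : ∀ {a₁ a m C D} → a₁ ≤ a → AgreeBelow m C D → AgreeBelow (m * a₁) (scale a C) (scale a D)
scale-agree-≥ {a = a} {m} a₁≤a C≈D i i<K = scale-agree a C≈D i (<-≤-trans i<K (*-monoʳ-≤ m a₁≤a))

scale-TruncEqM : ∀ {a N C D} → 0 < a → TruncEqM N C D → TruncEqM N (scale a C) (scale a D)
scale-TruncEqM {a} 0<a C≈D i i≤N = scale-cong a (λ q qa≡i → C≈D q (≤-trans (quotient-≤ 0<a qa≡i) i≤N))

sumUpTo-cong : ∀ i {f g} → (∀ j → j ≤ i → f j ≡ g j) → sumUpTo i f ≡ sumUpTo i g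
sumUpTo-cong zero    f≈g = f≈g 0 z≤n
sumUpTo-cong (suc i) f≈g =
  cong₂ _+_ (sumUpTo-cong i (λ j j≤i → f≈g j (m≤n⇒m≤1+n j≤i))) (f≈g (suc i) ≤-refl)

sumUpTo-vanish : ∀ i {f} → (∀ j → j ≤ i → f j ≡ 0) → sumUpTo i f ≡ 0
sumUpTo-vanish zero    f≈0 = f≈0 0 z≤n
sumUpTo-vanish (suc i) f≈0 =
  cong₂ _+_ (sumUpTo-vanish i (λ j j≤i → f≈0 j (m≤n⇒m≤1+n j≤i))) (f≈0 (suc i) ≤-refl)

sumUpTo-≥-last : ∀ i f → f i ≤ sumUpTo i f
sumUpTo-≥-last zero    f = ≤-refl
sumUpTo-≥-last (suc i) f = m≤n+m (f (suc i)) (sumUpTo i f)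

sumUpTo-interior : ∀ k {f g} → (∀ j → 0 < j → j ≤ k → f j ≡ g j) →
  ∃[ R ] (sumUpTo k f ≡ f 0 + R × sumUpTo k g ≡ g 0 + R)
sumUpTo-interior zero _ = 0 , sym (+-identityʳ _) , sym (+-identityʳ _)
sumUpTo-interior (suc k) {f} {g} f≈g with sumUpTo-interior k (λ j 0<j j≤k → f≈g j 0<j (m≤n⇒m≤1+n j≤k))
... | R , f-sum , g-sum =
  R + f (suc k) ,
  trans (cong (_+ f (suc k)) f-sum) (+-assoc (f 0) R _) ,
  trans (cong₂ _+_ g-sum (sym (f≈g (suc k) z<s ≤-refl))) (+-assoc (g 0) R _)

⊕-cong-≤ : ∀ i {P Q X Y} → TruncEqM i P Q → TruncEqM i X Y → (P ⊕ X) i ≡ (Q ⊕ Y) i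
⊕-cong-≤ i P≈Q X≈Y = sumUpTo-cong i (λ j j≤i → cong₂ _*_ (P≈Q j j≤i) (X≈Y (i ∸ j) (m∸n≤m i j)))

⊕-agree : ∀ {K P Q X Y} → AgreeBelow K P Q → AgreeBelow K X Y → AgreeBelow K (P ⊕ X) (Q ⊕ Y)
⊕-agree P≈Q X≈Y i i<K =
  ⊕-cong-≤ i (λ j j≤i → P≈Q j (≤-<-trans j≤i i<K)) (λ j j≤i → X≈Y j (≤-<-trans j≤i i<K))

-- The interior terms of the convolution only involve indices below k + 1, hence are shared.
⊕-top : ∀ k {P Q X Y} → AgreeBelow (suc k) P Q → AgreeBelow (suc k) X Y →
  ∃[ R ] ((P ⊕ X) (suc k) ≡ P 0 * X (suc k) + R + P (suc k) * X 0
        × (Q ⊕ Y) (suc k) ≡ Q 0 * Y (suc k) + R + Q (suc k) * Y 0)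
⊕-top k {P} {Q} {X} {Y} P≈Q X≈Y
  with sumUpTo-interior k {λ i → P i * X (suc k ∸ i)} {λ i → Q i * Y (suc k ∸ i)}
  (λ j 0<j j≤k → cong₂ _*_ (P≈Q j (s≤s j≤k)) (X≈Y (suc k ∸ j) (∸-monoʳ-< 0<j (m≤n⇒m≤1+n j≤k))))
... | R , PX-sum , QY-sum =
  R , cong₂ _+_ PX-sum (cong (λ j → P (suc k) * X j) (n∸n≡0 k))
    , cong₂ _+_ QY-sum (cong (λ j → Q (suc k) * Y j) (n∸n≡0 k))

⊕-cancelˡ : ∀ {N P Q X Y} → P 0 ≡ 1 → TruncEqM N P Q → TruncEqM N (P ⊕ X) (Q ⊕ Y) → TruncEqM N X Y
⊕-cancelˡ {N} {P} {Q} {X} {Y} P0 P≈Q PX≈QY = agree-upTo N step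
  where
  Q0 : Q 0 ≡ 1
  Q0 = trans (sym (P≈Q 0 z≤n)) P0
  unit-first : ∀ {A a} → A ≡ 1 → ∀ R s → A * a + R + s ≡ a + (R + s)
  unit-first {a = a} refl R s = solve 3 (λ a R s → con 1 :* a :+ R :+ s := a :+ (R :+ s)) refl a R s
  step : ∀ m → m ≤ N → AgreeBelow m X Y → X m ≡ Y m
  step zero _ _ = begin
    X 0         ≡⟨ sym (*-identityˡ (X 0)) ⟩
    1 * X 0     ≡⟨ cong (_* X 0) (sym P0) ⟩
    P 0 * X 0   ≡⟨ PX≈QY 0 z≤n ⟩
    Q 0 * Y 0   ≡⟨ cong (_* Y 0) Q0 ⟩
    1 * Y 0     ≡⟨ *-identityˡ (Y 0) ⟩
    Y 0         ∎
    where open ≡-Reasoning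
  step (suc k) k<N X≈Y with ⊕-top k (λ i i≤k → P≈Q i (≤-trans (<⇒≤ i≤k) k<N)) X≈Y
  ... | R , PX-top , QY-top = +-cancelʳ-≡ (R + t) _ _ (begin
    X (suc k) + (R + t)                      ≡⟨ sym (unit-first P0 R t) ⟩
    P 0 * X (suc k) + R + t                  ≡⟨ sym PX-top ⟩
    (P ⊕ X) (suc k)                          ≡⟨ PX≈QY (suc k) k<N ⟩
    (Q ⊕ Y) (suc k)                          ≡⟨ QY-top ⟩
    Q 0 * Y (suc k) + R + Q (suc k) * Y 0    ≡⟨ unit-first Q0 R _ ⟩
    Y (suc k) + (R + Q (suc k) * Y 0)        ≡⟨ cong (λ s → Y (suc k) + (R + s)) (sym P≈Q-top) ⟩
    Y (suc k) + (R + t)                      ∎)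
    where
    open ≡-Reasoning
    t = P (suc k) * X 0
    P≈Q-top : t ≡ Q (suc k) * Y 0
    P≈Q-top = cong₂ _*_ (P≈Q (suc k) k<N) (X≈Y 0 z<s)

DifferAt : ℕ → Multiset → Multiset → ℕ → ℕ → ℕ → Set
DifferAt K A B c u v = ∃[ R ] (A K ≡ R + c * u × B K ≡ R + c * v)

DifferAt-cancel : ∀ {K A B c u v} → 0 < c → DifferAt K A B c u v → A K ≡ B K → u ≡ v
DifferAt-cancel {c = suc c} {u} {v} _ (R , A-split , B-split) AK≡BK =
  *-cancelˡ-≡ u v (suc c) (+-cancelˡ-≡ R _ _ (trans (sym A-split) (trans AK≡BK B-split)))

DifferAt-+ : ∀ {K A B A' B' c d u v} → DifferAt K A B c u v → DifferAt K A' B' d u v →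
  DifferAt K (λ i → A i + A' i) (λ i → B i + B' i) (c + d) u v
DifferAt-+ {c = c} {d} {u} {v} (R , A-split , B-split) (R' , A'-split , B'-split) =
  R + R' , trans (cong₂ _+_ A-split A'-split) (regroup u) , trans (cong₂ _+_ B-split B'-split) (regroup v)
  where
  regroup : ∀ w → R + c * w + (R' + d * w) ≡ R + R' + (c + d) * w
  regroup = solve 5 (λ R R' c d w → R :+ c :* w :+ (R' :+ d :* w) := R :+ R' :+ (c :+ d) :* w) refl R R' c d

DifferAt-⊕ : ∀ {K P Q X Y c d u v} → 0 < K → P 0 ≡ 1 → Q 0 ≡ 1 → X 0 ≡ 1 → Y 0 ≡ 1 →
  AgreeBelow K P Q → AgreeBelow K X Y → DifferAt K P Q c u v → DifferAt K X Y d u v →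
  DifferAt K (P ⊕ X) (Q ⊕ Y) (c + d) u v
DifferAt-⊕ {suc k} {c = c} {d} _ P0 Q0 X0 Y0 P≈Q X≈Y (Rp , P-split , Q-split) (Rx , X-split , Y-split)
  with ⊕-top k P≈Q X≈Y
... | R , PX-top , QY-top =
  Rp + R + Rx , trans PX-top (combine P0 X-split P-split X0) , trans QY-top (combine Q0 Y-split Q-split Y0)
  where
  combine : ∀ {A₀ Aₖ Bₖ B₀ w} → A₀ ≡ 1 → Bₖ ≡ Rx + d * w → Aₖ ≡ Rp + c * w → B₀ ≡ 1 →
    A₀ * Bₖ + R + Aₖ * B₀ ≡ Rp + R + Rx + (c + d) * w
  combine {w = w} refl refl refl refl =
    solve 6 (λ Rp R Rx c d w → con 1 :* (Rx :+ d :* w) :+ R :+ (Rp :+ c :* w) :* con 1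
                               := Rp :+ R :+ Rx :+ (c :+ d) :* w) refl Rp R Rx c d w

scale-differAt : ∀ {a₁ a m f g} → 0 < a₁ → 0 < m → a₁ ≤ a → AgreeBelow m f g →
  DifferAt (m * a₁) (scale a f) (scale a g) (multiplicity [ a ] a₁) (f m) (g m)
scale-differAt {a₁} {a} {m} {f} {g} 0<a₁ 0<m a₁≤a f≈g with a ≟ a₁
... | yes refl = 0 , at-top f , at-top g
  where
  at-top : ∀ h → scale a h (m * a) ≡ multiplicity [ a ] a * h m
  at-top h = trans (scale-multiple 0<a₁ h m)
    (sym (trans (cong (_* h m) (multiplicity-here a [])) (*-identityˡ (h m))))
... | no a≢a₁ = scale a f (m * a₁) , without f , trans (sym f≈g-top) (without g)
  where
  without : ∀ h → scale a f (m * a₁) ≡ scale a f (m * a₁) + multiplicity [ a ] a₁ * h m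
  without h rewrite multiplicity-there [] a≢a₁ = sym (+-identityʳ _)
  f≈g-top : scale a f (m * a₁) ≡ scale a g (m * a₁)
  f≈g-top = scale-agree a f≈g (m * a₁) (*-monoʳ-< m {{>-nonZero 0<m}} (≤∧≢⇒< a₁≤a (≢-sym a≢a₁)))

zeroMS-positive : ∀ {K} → 0 < K → zeroMS K ≡ 0
zeroMS-positive {suc _} _ = refl

vecMul-0 : ∀ {α C} → All (0 <_) α → C 0 ≡ 1 → vecMul α C 0 ≡ 1
vecMul-0 []            C0 = refl
vecMul-0 {C = C} (0<a ∷ α+) C0 = cong₂ _*_ (trans (scale-0 0<a C) C0) (vecMul-0 α+ C0)

vecMul-agree : ∀ {a₁ m C D} L → All (a₁ ≤_) L → AgreeBelow m C D →
  AgreeBelow (m * a₁) (vecMul L C) (vecMul L D)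
vecMul-agree []      _               _   _ _ = refl
vecMul-agree (a ∷ L) (a₁≤a ∷ a₁≤L) C≈D =
  ⊕-agree (scale-agree-≥ a₁≤a C≈D) (vecMul-agree L a₁≤L C≈D)

vecMul-vanish : ∀ {k m F} β → 0 < m → (∀ q → 0 < q → q < k → F q ≡ 0) → All (λ b → m < k * b) β →
  vecMul β F m ≡ 0
vecMul-vanish [] 0<m _ _ = zeroMS-positive 0<m
vecMul-vanish {k} {m} {F} (b ∷ β) 0<m F-gap (m<kb ∷ m<kβ) = sumUpTo-vanish m term
  where
  term : ∀ j → j ≤ m → scale b F j * vecMul β F (m ∸ j) ≡ 0
  term zero _ = trans (cong (scale b F 0 *_) (vecMul-vanish β 0<m F-gap m<kβ)) (*-zeroʳ (scale b F 0))
  term (suc j) 1+j≤m = cong (_* vecMul β F (m ∸ suc j)) (scale-vanish b gap)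
    where
    gap : ∀ q → q * b ≡ suc j → F q ≡ 0
    gap zero    ()
    gap (suc q) qb≡1+j =
      F-gap (suc q) z<s (*-cancelʳ-< b (suc q) k (≤-<-trans (≤-trans (≤-reflexive qb≡1+j) 1+j≤m) m<kb))

vecMul-head-positive : ∀ {c a as E} → 0 < a → All (0 <_) as → E 0 ≡ 1 → 0 < E c →
  0 < vecMul (a ∷ as) E (c * a)
vecMul-head-positive {c} {a} {as} {E} 0<a as+ E0 0<Ec =
  <-≤-trans 0<Ec (≤-trans (≤-reflexive (sym last-term)) (sumUpTo-≥-last (c * a) _))
  where
  last-term : scale a E (c * a) * vecMul as E (c * a ∸ c * a) ≡ E c
  last-term = trans
    (cong₂ _*_ (scale-multiple 0<a E c) (trans (cong (vecMul as E) (n∸n≡0 (c * a))) (vecMul-0 as+ E0)))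
    (*-identityʳ (E c))

vecMul-least-unmatched : ∀ {c a as L E F} → 0 < c → 0 < a → All (0 <_) as → E 0 ≡ 1 → 0 < E c →
  (∀ q → 0 < q → q < c → F q ≡ 0) → All (a <_) L → vecMul (a ∷ as) E (c * a) ≢ vecMul L F (c * a)
vecMul-least-unmatched {c} {a} {L = L} {E} 0<c 0<a as+ E0 0<Ec F-gap a<L eq =
  <⇒≢ (vecMul-head-positive {c} {E = E} 0<a as+ E0 0<Ec)
    (sym (trans eq (vecMul-vanish L (*-positive 0<c 0<a) F-gap (All.map (*-monoʳ-< c {{>-nonZero 0<c}}) a<L))))

vecMul-above : ∀ {N C} α → All (N <_) α → C 0 ≡ 1 → TruncEqM N (vecMul α C) zeroMS
vecMul-above α N<α C0 zero    _       = vecMul-0 (All.map (≤-<-trans z≤n) N<α) C0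
vecMul-above α N<α C0 (suc i) 1+i≤N =
  vecMul-vanish α z<s (λ _ 0<q q<1 → ⊥-elim (<⇒≱ q<1 0<q))
    (All.map (λ N<b → subst (suc i <_) (sym (*-identityˡ _)) (≤-<-trans 1+i≤N N<b)) N<α)

vecMul-truncV : ∀ {N C} α → Sorted α → All (0 <_) α → C 0 ≡ 1 →
  TruncEqM N (vecMul (truncV N α) C) (vecMul α C)
vecMul-truncV [] _ _ _ _ _ = refl
vecMul-truncV {N} {C} (a ∷ as) α↗ (_ ∷ as+) C0 i i≤N with a ≤? N
... | yes a≤N = trans (cong (λ l → vecMul l C i) (truncV-≤ as a≤N))
                  (⊕-cong-≤ i {scale a C} (λ _ _ → refl)
                    (λ j j≤i → vecMul-truncV {C = C} as (Linked.tail α↗) as+ C0 j (≤-trans j≤i i≤N)))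
... | no  a≰N = trans (cong (λ l → vecMul l C i) (truncV-> as (≰⇒> a≰N)))
                  (sym (vecMul-above (a ∷ as) (Sorted⇒All-> (≰⇒> a≰N) α↗) C0 i i≤N))

vecMul-differAt : ∀ {a₁ m C D} L → 0 < a₁ → 0 < m → C 0 ≡ 1 → D 0 ≡ 1 →
  AgreeBelow m C D → All (a₁ ≤_) L →
  DifferAt (m * a₁) (vecMul L C) (vecMul L D) (multiplicity L a₁) (C m) (D m)
vecMul-differAt [] 0<a₁ 0<m _ _ _ _ = 0 , K-empty , K-empty
  where K-empty = zeroMS-positive (*-positive 0<m 0<a₁)
vecMul-differAt {a₁} {m} {C} {D} (a ∷ L) 0<a₁ 0<m C0 D0 C≈D (a₁≤a ∷ a₁≤L) =
  subst (λ c → DifferAt (m * a₁) (vecMul (a ∷ L) C) (vecMul (a ∷ L) D) c (C m) (D m))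
    (sym (multiplicity-++ [ a ] L a₁))
    (DifferAt-⊕ {c = multiplicity [ a ] a₁} {multiplicity L a₁} {C m} {D m} (*-positive 0<m 0<a₁)
      (trans (scale-0 0<a C) C0) (trans (scale-0 0<a D) D0) (vecMul-0 L+ C0) (vecMul-0 L+ D0)
      (scale-agree-≥ a₁≤a C≈D) (vecMul-agree L a₁≤L C≈D)
      (scale-differAt 0<a₁ 0<m a₁≤a C≈D) (vecMul-differAt L 0<a₁ 0<m C0 D0 C≈D a₁≤L))
  where
  0<a = <-≤-trans 0<a₁ a₁≤a
  L+ = All.map (<-≤-trans 0<a₁) a₁≤L

scaleSum : List ℕ → Multiset → Multiset
scaleSum []      f x = 0
scaleSum (a ∷ α) f x = scale a f x + scaleSum α f x

multiplicity-vecProd : ∀ {α} α' → All (0 <_) α → ∀ x →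
  multiplicity (vecProd α α') x ≡ scaleSum α (multiplicity α') x
multiplicity-vecProd {α} α' α+ x = trans (multiplicity-↭ x (sort-↭ _)) (products α α+)
  where
  products : ∀ α → All (0 <_) α →
    multiplicity (concatMap (λ a → map (a *_) α') α) x ≡ scaleSum α (multiplicity α') x
  products []      []          = refl
  products (a ∷ α) (0<a ∷ α+) = trans (multiplicity-++ (map (a *_) α') _ x)
    (cong₂ _+_ (multiplicity-scale 0<a α' x) (products α α+))

scaleSum-vanish : ∀ {x f} α → All (x <_) α → 0 < x → scaleSum α f x ≡ 0
scaleSum-vanish []      []            _   = refl
scaleSum-vanish (a ∷ α) (x<a ∷ x<α) 0<x =
  cong₂ _+_ (scale-vanish a (λ q qa≡x → ⊥-elim (<⇒≱ x<a (multiple-≥ {q} qa≡x 0<x))))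
            (scaleSum-vanish α x<α 0<x)

scaleSum-truncV : ∀ {N f x} α → Sorted α → 0 < x → x ≤ N → scaleSum (truncV N α) f x ≡ scaleSum α f x
scaleSum-truncV [] _ _ _ = refl
scaleSum-truncV {N} {f} {x} (a ∷ as) α↗ 0<x x≤N with a ≤? N
... | yes a≤N = trans (cong (λ l → scaleSum l f x) (truncV-≤ as a≤N))
                  (cong (scale a f x +_) (scaleSum-truncV as (Linked.tail α↗) 0<x x≤N))
... | no  a≰N = trans (cong (λ l → scaleSum l f x) (truncV-> as (≰⇒> a≰N)))
                  (sym (scaleSum-vanish (a ∷ as) (Sorted⇒All-> (≤-<-trans x≤N (≰⇒> a≰N)) α↗) 0<x))

scaleSum-differAt : ∀ {a₁ m f g} L → 0 < a₁ → 0 < m → AgreeBelow m f g → All (a₁ ≤_) L →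
  DifferAt (m * a₁) (scaleSum L f) (scaleSum L g) (multiplicity L a₁) (f m) (g m)
scaleSum-differAt [] _ _ _ _ = 0 , refl , refl
scaleSum-differAt {a₁} {m} {f} {g} (a ∷ L) 0<a₁ 0<m f≈g (a₁≤a ∷ a₁≤L) =
  subst (λ c → DifferAt (m * a₁) (scaleSum (a ∷ L) f) (scaleSum (a ∷ L) g) c (f m) (g m))
    (sym (multiplicity-++ [ a ] L a₁))
    (DifferAt-+ {A = scale a f} {scale a g} {scaleSum L f} {scaleSum L g}
                {multiplicity [ a ] a₁} {multiplicity L a₁} {f m} {g m}
      (scale-differAt 0<a₁ 0<m a₁≤a f≈g) (scaleSum-differAt L 0<a₁ 0<m f≈g a₁≤L))

truncV-≡-from-vecMul : ∀ n {c₂ C D α β} → 0 < c₂ → C 0 ≡ 1 → D 0 ≡ 1 → 0 < C c₂ →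
  (∀ q → 0 < q → q < c₂ → C q ≡ 0) → InZm α → InZm β →
  TruncEqM (c₂ * n) (vecMul α C) (vecMul β D) → TruncEqM (c₂ * n) C D → truncV n α ≡ truncV n β
truncV-≡-from-vecMul n {c₂} {C} {D} 0<c₂ C0 D0 0<Cc₂ C-gap (α+ , α↗) (β+ , β↗) αC≈βD C≈D =
  truncV-≡-byLeast n Matching unmatchedˡ unmatchedʳ matching-tail α↗ β↗ (α+ , β+ , αC≈βD)
  where
  N = c₂ * n
  Matching : List ℕ → List ℕ → Set
  Matching α β = All (0 <_) α × All (0 <_) β × TruncEqM N (vecMul α C) (vecMul β D)
  scaled≤N : ∀ {a} → a ≤ n → c₂ * a ≤ N
  scaled≤N = *-monoʳ-≤ c₂
  c₂≤N : ∀ {a} → 0 < a → a ≤ n → c₂ ≤ N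
  c₂≤N {a} 0<a a≤n = ≤-trans (m≤m*n c₂ a {{>-nonZero 0<a}}) (scaled≤N a≤n)
  D-gap : c₂ ≤ N → ∀ q → 0 < q → q < c₂ → D q ≡ 0
  D-gap c₂≤N q 0<q q<c₂ = trans (sym (C≈D q (≤-trans (<⇒≤ q<c₂) c₂≤N))) (C-gap q 0<q q<c₂)
  unmatchedˡ : ∀ {a as L} → a ≤ n → All (a <_) L → Matching (a ∷ as) L → ⊥
  unmatchedˡ a≤n a<L ((0<a ∷ as+) , _ , h) =
    vecMul-least-unmatched 0<c₂ 0<a as+ C0 0<Cc₂ (D-gap (c₂≤N 0<a a≤n)) a<L (h _ (scaled≤N a≤n))
  unmatchedʳ : ∀ {a as L} → a ≤ n → All (a <_) L → Matching L (a ∷ as) → ⊥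
  unmatchedʳ a≤n a<L (_ , (0<a ∷ as+) , h) =
    vecMul-least-unmatched 0<c₂ 0<a as+ D0 (subst (0 <_) (C≈D c₂ (c₂≤N 0<a a≤n)) 0<Cc₂) C-gap a<L
      (sym (h _ (scaled≤N a≤n)))
  matching-tail : ∀ {a as bs} → a ≤ n → Matching (a ∷ as) (a ∷ bs) → Matching as bs
  matching-tail _ ((0<a ∷ as+) , (_ ∷ bs+) , h) =
    as+ , bs+ , ⊕-cancelˡ (trans (scale-0 0<a C) C0) (scale-TruncEqM 0<a C≈D) h

TruncEqM-from-vecMul : ∀ n {a₁ as b₁ bs C D} → InZm (a₁ ∷ as) → InZm (b₁ ∷ bs) →
  C 0 ≡ 1 → D 0 ≡ 1 →
  truncV (a₁ * n) (a₁ ∷ as) ≡ truncV (a₁ * n) (b₁ ∷ bs) →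
  TruncEqM (a₁ * n) (vecMul (a₁ ∷ as) C) (vecMul (b₁ ∷ bs) D) → TruncEqM n C D
TruncEqM-from-vecMul n {a₁} {as} {b₁} {bs} {C} {D} (α+@(0<a₁ ∷ _) , α↗) (β+ , β↗) C0 D0 α≡β αC≈βD =
  agree-upTo n step
  where
  N = a₁ * n
  L = truncV N (a₁ ∷ as)
  LC≈LD : TruncEqM N (vecMul L C) (vecMul L D)
  LC≈LD i i≤N = begin
    vecMul L C i                    ≡⟨ vecMul-truncV (a₁ ∷ as) α↗ α+ C0 i i≤N ⟩
    vecMul (a₁ ∷ as) C i            ≡⟨ αC≈βD i i≤N ⟩
    vecMul (b₁ ∷ bs) D i            ≡⟨ sym (vecMul-truncV (b₁ ∷ bs) β↗ β+ D0 i i≤N) ⟩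
    vecMul (truncV N (b₁ ∷ bs)) D i ≡⟨ cong (λ l → vecMul l D i) (sym α≡β) ⟩
    vecMul L D i                    ∎
    where open ≡-Reasoning
  step : ∀ m → m ≤ n → AgreeBelow m C D → C m ≡ D m
  step zero    _   _   = trans C0 (sym D0)
  step (suc m) m≤n C≈D =
    DifferAt-cancel {A = vecMul L C} {vecMul L D}
      (multiplicity-truncV-head as (≤-trans (m≤n*m a₁ (suc m)) K≤N))
      (vecMul-differAt {m = suc m} L 0<a₁ z<s C0 D0 C≈D (takeWhile⁺ _ (Sorted⇒All-≥ α↗)))
      (LC≈LD _ K≤N)
    where
    K≤N : suc m * a₁ ≤ N
    K≤N = ≤-trans (*-monoˡ-≤ a₁ m≤n) (≤-reflexive (*-comm n a₁))

truncV-≡-from-vecProd : ∀ n {a₁ as b₁ bs α' β'} →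
  InZm (a₁ ∷ as) → InZm (b₁ ∷ bs) → InZm α' → InZm β' →
  truncV (a₁ * n) (a₁ ∷ as) ≡ truncV (a₁ * n) (b₁ ∷ bs) →
  truncV (a₁ * n) (vecProd (a₁ ∷ as) α') ≡ truncV (a₁ * n) (vecProd (b₁ ∷ bs) β') →
  truncV n α' ≡ truncV n β'
truncV-≡-from-vecProd n {a₁} {as} {b₁} {bs} {α'} {β'}
  (α+@(0<a₁ ∷ _) , α↗) (β+ , β↗) (α'+ , α'↗) (β'+ , β'↗) α≡β αα'≡ββ' =
  truncV-≡-byMultiplicity α'↗ β'↗ (agree-upTo n step)
  where
  N = a₁ * n
  L = truncV N (a₁ ∷ as)
  f = multiplicity α'
  g = multiplicity β'
  Lf≈Lg : ∀ x → 0 < x → x ≤ N → scaleSum L f x ≡ scaleSum L g x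
  Lf≈Lg x 0<x x≤N = begin
    scaleSum L f x                                   ≡⟨ scaleSum-truncV (a₁ ∷ as) α↗ 0<x x≤N ⟩
    scaleSum (a₁ ∷ as) f x                           ≡⟨ sym (multiplicity-vecProd α' α+ x) ⟩
    multiplicity (vecProd (a₁ ∷ as) α') x            ≡⟨ sym (multiplicity-truncV _ (sort-↗ _) x≤N) ⟩
    multiplicity (truncV N (vecProd (a₁ ∷ as) α')) x ≡⟨ cong (λ l → multiplicity l x) αα'≡ββ' ⟩
    multiplicity (truncV N (vecProd (b₁ ∷ bs) β')) x ≡⟨ multiplicity-truncV _ (sort-↗ _) x≤N ⟩
    multiplicity (vecProd (b₁ ∷ bs) β') x            ≡⟨ multiplicity-vecProd β' β+ x ⟩
    scaleSum (b₁ ∷ bs) g x                           ≡⟨ sym (scaleSum-truncV (b₁ ∷ bs) β↗ 0<x x≤N) ⟩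
    scaleSum (truncV N (b₁ ∷ bs)) g x                ≡⟨ cong (λ l → scaleSum l g x) (sym α≡β) ⟩
    scaleSum L g x                                   ∎
    where open ≡-Reasoning
  step : ∀ m → m ≤ n → AgreeBelow m f g → f m ≡ g m
  step zero    _   _   = trans (multiplicity-absent α'+) (sym (multiplicity-absent β'+))
  step (suc m) m≤n f≈g =
    DifferAt-cancel {A = scaleSum L f} {scaleSum L g}
      (multiplicity-truncV-head as (≤-trans (m≤n*m a₁ (suc m)) K≤N))
      (scaleSum-differAt {m = suc m} L 0<a₁ z<s f≈g (takeWhile⁺ _ (Sorted⇒All-≥ α↗)))
      (Lf≈Lg _ (*-positive {suc m} z<s 0<a₁) K≤N)
    where
    K≤N : suc m * a₁ ≤ N
    K≤N = ≤-trans (*-monoˡ-≤ a₁ m≤n) (≤-reflexive (*-comm n a₁))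

lemma2p1 : (n : ℕ) → 1 ≤ n →
    ((C D : Multiset) → InNm C → InNm D → CardGe2 C → CardGe2 D →
      (c₂ : ℕ) → 0 < c₂ → 1 ≤ C c₂ → (∀ m → 0 < m → m < c₂ → C m ≡ 0) →
      (a₁ b₁ : ℕ) (as bs : List ℕ) → InZm (a₁ ∷ as) → InZm (b₁ ∷ bs) →
      TruncEqM (c₂ * n) (vecMul (a₁ ∷ as) C) (vecMul (b₁ ∷ bs) D) →
      TruncEqM (c₂ * n) C D →
      truncV n (a₁ ∷ as) ≡ truncV n (b₁ ∷ bs))
    ×
    ((a₁ b₁ : ℕ) (as bs : List ℕ) → InZm (a₁ ∷ as) → InZm (b₁ ∷ bs) →
      (C D : Multiset) → InNm C → InNm D →
      truncV (a₁ * n) (a₁ ∷ as) ≡ truncV (a₁ * n) (b₁ ∷ bs) →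
      TruncEqM (a₁ * n) (vecMul (a₁ ∷ as) C) (vecMul (b₁ ∷ bs) D) →
      TruncEqM n C D)
    ×
    ((a₁ b₁ a₁' b₁' : ℕ) (as bs as' bs' : List ℕ) →
      InZm (a₁ ∷ as) → InZm (b₁ ∷ bs) → InZm (a₁' ∷ as') → InZm (b₁' ∷ bs') →
      truncV (a₁ * n) (a₁ ∷ as) ≡ truncV (a₁ * n) (b₁ ∷ bs) →
      truncV (a₁ * n) (vecProd (a₁ ∷ as) (a₁' ∷ as'))
        ≡ truncV (a₁ * n) (vecProd (b₁ ∷ bs) (b₁' ∷ bs')) →
      truncV n (a₁' ∷ as') ≡ truncV n (b₁' ∷ bs'))
lemma2p1 n _ =
    (λ C D C0 D0 _ _ c₂ 0<c₂ 0<Cc₂ C-gap _ _ _ _ → truncV-≡-from-vecMul n 0<c₂ C0 D0 0<Cc₂ C-gap)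
  , (λ _ _ _ _ α β C D C0 D0 → TruncEqM-from-vecMul n α β C0 D0)
  , (λ _ _ _ _ _ _ _ _ → truncV-≡-from-vecProd n)
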